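{- There exists a family $\mathcal{F}\subseteq\mathcal{P}(\mathbb{Z}^{\omega})$ such that $\mathcal{F}=\mathcal{F}^{*}$.
   Context: $\mathbb{Z}^\omega$ is the group of all integer sequences under coordinatewise addition. For $A,B\subseteq\mathbb{Z}^\omega$, $A+B=\{a+b:a\in A,b\in B\}$. For $\mathcal{F}\subseteq\mathcal{P}(\mathbb{Z}^\omega)$, $\mathcal{F}^{*}=\{A\subseteq\mathbb{Z}^\omega:\ \forall F\in\mathcal{F}\ \ A+F\neq\mathbb{Z}^\omega\}$. -}

module Defs where

open import Data.Nat using (ℕ)
open import Data.Integer using (ℤ; _+_)
open import Data.Product using (Σ; _×_)
open import Relation.Binary.PropositionalEquality using (_≡_)
open import Relation.Nullary using (¬_)
open import Level using (Level; suc)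

ℤω : Set
ℤω = ℕ → ℤ

Subset : Set₁
Subset = ℤω → Set

Family : Set₂
Family = Subset → Set₁

_∈Sum_,_ : ℤω → Subset → Subset → Set
z ∈Sum A , B = Σ ℤω λ a → Σ ℤω λ b → A a × B b × (∀ i → z i ≡ a i + b i)

SumsToAll : Subset → Subset → Set
SumsToAll A B = ∀ z → z ∈Sum A , B

_* : Family → Family
(𝓕 *) A = ∀ (B : Subset) → 𝓕 B → ¬ SumsToAll A B

_≐_ : Family → Family → Set₁
𝓕 ≐ 𝓖 = ∀ (A : Subset) → (𝓕 A → 𝓖 A) × (𝓖 A → 𝓕 A)

{-# OPTIONS --safe #-}
module Submission where

-- Let H (EvenHead) be the index-2 subgroup of sequences with even 0-th coordinate and
-- 𝓕 (headParityConstant) the family of sets lying in a single coset of H.  A set meeting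
-- both cosets satisfies A + H = ℤ^ω, and H ∈ 𝓕, so 𝓕* ⊆ 𝓕.  Conversely A + B lies in a
-- single coset for A, B ∈ 𝓕, so 𝓕 ⊆ 𝓕*.

open import Defs
open import Data.Product using (Σ; _,_)
open import Data.Sum using (_⊎_; inj₁; inj₂)
open import Data.Nat as ℕ using (s≤s)
import Data.Nat.Divisibility as ℕ
open import Data.Integer as ℤ using (+_; _+_; _-_)
open import Data.Integer.DivMod using (_%ℕ_; _/ℕ_; n%ℕd<d; a≡a%ℕn+[a/ℕn]*n)
open import Data.Integer.Properties using (+-identityˡ)
open import Data.Integer.Divisibility.Signed
  using (_∣_; divides; ∣⇒∣ᵤ; ∣m∣n⇒∣m+n; ∣m∣n⇒∣m-n; ∣m+n∣n⇒∣m; ∣-refl)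
open import Data.Integer.Tactic.RingSolver using (solve-∀)
open import Data.Empty using (⊥-elim)
open import Level using (Lift; lift; 0ℓ; suc)
open import Relation.Nullary using (¬_)
open import Relation.Binary.PropositionalEquality
  using (_≡_; sym; trans; cong; cong₂; subst; module ≡-Reasoning)

even⊎odd : ∀ n → + 2 ∣ n ⊎ + 2 ∣ + 1 + n
even⊎odd n with n %ℕ 2 | n%ℕd<d n 2 | a≡a%ℕn+[a/ℕn]*n n 2
... | 0 | _ | n≡2q = inj₁ (divides (n /ℕ 2) (trans n≡2q (+-identityˡ _)))
... | 1 | _ | n≡2q+1 = inj₂ (divides (+ 1 + n /ℕ 2)
  (trans (cong (_+_ (+ 1)) n≡2q+1) (1+[1+q*2]≡[1+q]*2 (n /ℕ 2))))
  where
  1+[1+q*2]≡[1+q]*2 : ∀ q → + 1 + (+ 1 + q ℤ.* + 2) ≡ (+ 1 + q) ℤ.* + 2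
  1+[1+q*2]≡[1+q]*2 = solve-∀
... | ℕ.suc (ℕ.suc _) | s≤s (s≤s ()) | _

2∤1 : ¬ + 2 ∣ + 1
2∤1 2∣1 with ℕ.∣1⇒≡1 (∣⇒∣ᵤ 2∣1)
... | ()

odd+odd⇒even : ∀ {m n} → + 2 ∣ + 1 + m → + 2 ∣ + 1 + n → + 2 ∣ m + n
odd+odd⇒even {m} {n} 2∣1+m 2∣1+n =
  ∣m+n∣n⇒∣m (subst (+ 2 ∣_) (regroup m n) (∣m∣n⇒∣m+n 2∣1+m 2∣1+n)) ∣-refl
  where
  regroup : ∀ m n → (+ 1 + m) + (+ 1 + n) ≡ (m + n) + + 2
  regroup = solve-∀

EvenHead : Subset
EvenHead x = + 2 ∣ x 0

HeadParityConstant : Subset → Set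
HeadParityConstant A = ∀ {x y} → A x → A y → + 2 ∣ x 0 - y 0

∈+EvenHead : ∀ {A : Subset} {x z} → A x → + 2 ∣ z 0 - x 0 → z ∈Sum A , EvenHead
∈+EvenHead {x = x} {z} Ax even = x , (λ i → z i - x i) , Ax , even , λ i → split (z i) (x i)
  where
  split : ∀ z x → z ≡ x + (z - x)
  split = solve-∀

oddHeadGap⇒+EvenHead-total : ∀ {A : Subset} {x y} → A x → A y →
                             + 2 ∣ + 1 + (x 0 - y 0) → SumsToAll A EvenHead
oddHeadGap⇒+EvenHead-total {x = x} {y} Ax Ay odd-gap z with even⊎odd (z 0 - x 0)
... | inj₁ even = ∈+EvenHead Ax even
... | inj₂ odd  = ∈+EvenHead Ay
  (subst (+ 2 ∣_) (telescope (z 0) (x 0) (y 0)) (odd+odd⇒even {z 0 - x 0} {x 0 - y 0} odd odd-gap))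
  where
  telescope : ∀ z x y → (z - x) + (x - y) ≡ z - y
  telescope = solve-∀

¬+EvenHead-total⇒headParityConstant : ∀ {A} → ¬ SumsToAll A EvenHead → HeadParityConstant A
¬+EvenHead-total⇒headParityConstant ¬total {x} {y} Ax Ay with even⊎odd (x 0 - y 0)
... | inj₁ even    = even
... | inj₂ odd-gap = ⊥-elim (¬total (oddHeadGap⇒+EvenHead-total Ax Ay odd-gap))

headParityConstant⇒¬total : ∀ {A B} → HeadParityConstant A → HeadParityConstant B →
                            ¬ SumsToAll A B
headParityConstant⇒¬total A-const B-const total
  with total (λ _ → + 1) | total (λ _ → + 0)
... | a , b , Aa , Bb , 1≡a+b | a′ , b′ , Aa′ , Bb′ , 0≡a′+b′ =
  2∤1 (subst (+ 2 ∣_) gaps≡1 (∣m∣n⇒∣m+n (A-const Aa Aa′) (B-const Bb Bb′)))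
  where
  open ≡-Reasoning
  regroup : ∀ a b a′ b′ → (a - a′) + (b - b′) ≡ (a + b) - (a′ + b′)
  regroup = solve-∀
  gaps≡1 : (a 0 - a′ 0) + (b 0 - b′ 0) ≡ + 1
  gaps≡1 = begin
    (a 0 - a′ 0) + (b 0 - b′ 0)   ≡⟨ regroup (a 0) (b 0) (a′ 0) (b′ 0) ⟩
    (a 0 + b 0) - (a′ 0 + b′ 0)   ≡⟨ cong₂ _-_ (sym (1≡a+b 0)) (sym (0≡a′+b′ 0)) ⟩
    + 1 - + 0                     ≡⟨⟩
    + 1                           ∎

headParityConstant : Family
headParityConstant A = Lift (suc 0ℓ) (HeadParityConstant A)

evenHead∈headParityConstant : headParityConstant EvenHead
evenHead∈headParityConstant = lift ∣m∣n⇒∣m-n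

mainTheorem5 : Σ Family λ 𝓕 → 𝓕 ≐ (𝓕 *)
mainTheorem5 = headParityConstant , λ A → ⊆𝓕* A , 𝓕*⊆ A
  where
  ⊆𝓕* : ∀ A → headParityConstant A → (headParityConstant *) A
  ⊆𝓕* A (lift A-const) B (lift B-const) = headParityConstant⇒¬total A-const B-const
  𝓕*⊆ : ∀ A → (headParityConstant *) A → headParityConstant A
  𝓕*⊆ A A∈𝓕* =
    lift (¬+EvenHead-total⇒headParityConstant (A∈𝓕* EvenHead evenHead∈headParityConstant))
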